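{- Let $D$ be a lock diagram and $T\in KKD(D)$. Then: (a) If column $c$ of $D$ is nonempty, then $\{r:(r,c)\in D\}=\{L_T(r,c):(r,c)\in T\}$ (the second set ranging over ordinary cells of $T$ in column $c$). (b) If $(r,c)\in T$ is an ordinary cell, then $r\le L_T(r,c)$. (c) If $(r_1,c),(r_2,c)\in T$ are ordinary cells with $r_1<r_2$, then $L_T(r_1,c)<L_T(r_2,c)$. (d) If $(r_1,c_1),(r_2,c_2)\in T$ are distinct ordinary cells with $L_T(r_1,c_1)=L_T(r_2,c_2)$, then $c_1\ne c_2$; moreover, if $c_1<c_2$ then $r_1\ge r_2$. (e) If $\langle r,c\rangle\in T$, then for every $\tilde T\in KKD(D)$ with $\tilde T\prec T$ we have $\langle r,c\rangle\in\tilde T$ and $L_{\tilde T}(r,c)=L_T(r,c)$. (f) If $\hat T$ is obtained from $T$ by a ghost move at row $r$ which moves the ordinary cell at $(r,c)$ to $(\hat r,c)$ and places a ghost cell $\langle r,c\rangle$, then $L_{\hat T}(r,c)=L_T(r,c)$. (g) If $\langle r,c\rangle\in T$, then $r\le L_T(r,c)$. (h) If $\langle r,c_1\rangle,\langle r,c_2\rangle\in T$ with $c_1<c_2$, then $L_T(r,c_1)<L_T(r,c_2)$. (i) If $\langle r,c_1\rangle,\langle r+1,c_2\rangle\in T$ with $L_T(r,c_1)<L_T(r+1,c_2)$, then $c_1<c_2$.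
   Context: A diagram is a finite set of cells at positions $(r,c)$ with $r,c$ positive integers ($r$ = row from the bottom, $c$ = column), at most one cell per position; each cell is either ordinary, written $(r,c)$, or a ghost cell, written $\langle r,c\rangle$. A position is empty if it contains no cell. K-Kohnert move at row $r$ of $D$: let the rightmost cell of row $r$ (ghost or not) lie in column $c$. The move does nothing if that cell is a ghost cell, or every position $(r',c)$ with $r'<r$ is occupied, or, letting $\hat r<r$ be maximal with $(\hat r,c)$ empty, some $(r^*,c)$ with $\hat r<r^*<r$ holds a ghost cell. Otherwise there are two choices: the Kohnert move moves the cell from $(r,c)$ to $(\hat r,c)$; the ghost move does the same and additionally places a ghost cell $\langle r,c\rangle$ at $(r,c)$. $KKD(D)$ (resp. $KD(D)$) is the set of $D$ and all diagrams obtained from $D$ by finite sequences of K-Kohnert moves (resp. Kohnert moves only). For $T_1,T_2\in KKD(D)$, $T_2\prec T_1$ means $T_2\neq T_1$ can be obtained from $T_1$ by a sequence of K-Kohnert moves. Lock diagram: for $\alpha=(\alpha_1,\dots,\alpha_n)\in\mathbb{Z}_{\ge0}^n$ with $N=\max_i\alpha_i$, it is $\bigcup_{i=1}^n\{(i,N-j):0\le j\le\alpha_i-1\}$. A lock tableau of content $\alpha$ is a diagram of ordinary cells filled with entries $1^{\alpha_1},\dots,n^{\alpha_n}$, one per cell, such that: (i) if $\alpha_j>0$ there is exactly one entry $j$ in each column from $N-\alpha_j+1$ through $N$; (ii) each entry in row $r$ is at least $r$; (iii) the cells with entry $j$ weakly descend from left to right; (iv) entries strictly decrease down columns. It is known (Assaf–Searles)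 that the underlying diagrams of lock tableaux of content $\alpha$ are exactly the elements of $KD(D)$ for $D$ the lock diagram of $\alpha$; each $T\in KD(D)$ is given the labeling of its associated lock tableau. For $T\in KKD(D)$, its set of ordinary cells lies in $KD(D)$, and the label $L_T(r,c)$ of an ordinary cell $(r,c)\in T$ is its entry in that tableau; for a ghost cell $\langle r,c\rangle\in T$, set $L_T(r,c)=L_T(r^*,c)$ where $r^*\le r$ is maximal with $(r^*,c)$ an ordinary cell of $T$. -}

module Defs where

open import Data.Nat using (ℕ; zero; suc; _≤_; _<_; _∸_; _⊔_; _≤ᵇ_; _<ᵇ_)
open import Data.Bool using (Bool; true; false; if_then_else_; _∧_)
open import Data.Vec using (Vec; []; _∷_; foldr)
open import Data.Product using (_×_; ∃-syntax)
open import Relation.Binary.PropositionalEquality using (_≡_; _≢_)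
open import Relation.Nullary using (¬_)

data Cell : Set where
  ∅ : Cell
  ● : Cell   -- ordinary cell (r,c)
  ◌ : Cell   -- ghost cell ⟨r,c⟩

-- A diagram: D r c is the content of position (row r, column c).
-- Only positions with r,c ≥ 1 are meaningful; all diagrams considered
-- here (lock diagrams and everything reachable from them) are finite and
-- empty in row 0 / column 0.
Diagram : Set
Diagram = ℕ → ℕ → Cell

_≗D_ : Diagram → Diagram → Set
D ≗D E = ∀ r c → D r c ≡ E r c

record MovePre (D : Diagram) (r c r̂ : ℕ) : Set where
  field
    ordinary   : D r c ≡ ●
    rightmost  : ∀ c′ → c < c′ → D r c′ ≡ ∅
    r̂-pos      : 1 ≤ r̂
    r̂<r        : r̂ < r
    r̂-empty    : D r̂ c ≡ ∅
    between    : ∀ r′ → r̂ < r′ → r′ < r → D r′ c ≡ ●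

record KohnertMove (D E : Diagram) (r c r̂ : ℕ) : Set where
  field
    pre   : MovePre D r c r̂
    new   : E r̂ c ≡ ●
    old   : E r c ≡ ∅
    other : ∀ p q → ¬ (p ≡ r̂ × q ≡ c) → ¬ (p ≡ r × q ≡ c) → E p q ≡ D p q

record GhostMove (D E : Diagram) (r c r̂ : ℕ) : Set where
  field
    pre   : MovePre D r c r̂
    new   : E r̂ c ≡ ●
    old   : E r c ≡ ◌
    other : ∀ p q → ¬ (p ≡ r̂ × q ≡ c) → ¬ (p ≡ r × q ≡ c) → E p q ≡ D p q

data KStep (D E : Diagram) : Set where
  kohnert : ∀ r c r̂ → KohnertMove D E r c r̂ → KStep D E

data KKStep (D E : Diagram) : Set where
  kohnert : ∀ r c r̂ → KohnertMove D E r c r̂ → KKStep D E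
  ghost   : ∀ r c r̂ → GhostMove D E r c r̂ → KKStep D E

data Reach (Step : Diagram → Diagram → Set) (D : Diagram) : Diagram → Set where
  here : ∀ {T} → T ≗D D → Reach Step D T
  step : ∀ {T U} → Reach Step D T → Step T U → Reach Step D U

KKD : Diagram → Diagram → Set
KKD D T = Reach KKStep D T

KD : Diagram → Diagram → Set
KD D T = Reach KStep D T

_≺_ : Diagram → Diagram → Set
T₂ ≺ T₁ = Reach KKStep T₁ T₂ × ¬ (T₂ ≗D T₁)

-- α_i for 1 ≤ i ≤ n (and 0 outside this range).
at : ∀ {n} → Vec ℕ n → ℕ → ℕ
at xs       zero          = 0
at []       (suc _)       = 0
at (x ∷ xs) (suc zero)    = x
at (x ∷ xs) (suc (suc k)) = at xs (suc k)

maxEntry : ∀ {n} → Vec ℕ n → ℕ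
maxEntry = foldr _ _⊔_ 0

-- lock diagram of α: cells (i, N - j) for 0 ≤ j ≤ α_i - 1, i.e. row i
-- has ordinary cells exactly in columns N - α_i + 1, …, N.
lockDiagram : ∀ {n} → Vec ℕ n → Diagram
lockDiagram {n} α r c =
  if (1 ≤ᵇ r) ∧ (r ≤ᵇ n) ∧ ((maxEntry α ∸ at α r) <ᵇ c) ∧ (c ≤ᵇ maxEntry α)
  then ● else ∅

Filling : Set
Filling = ℕ → ℕ → ℕ

-- τ is a lock tableau of content α whose underlying diagram is the set
-- of ordinary cells of T (τ r c is the entry of the cell (r,c)).
record IsLockTableau {n} (α : Vec ℕ n) (T : Diagram) (τ : Filling) : Set where
  field
    entry-range : ∀ r c → T r c ≡ ● → 1 ≤ τ r c × τ r c ≤ n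
    -- content α together with (i): entry j occurs exactly once in each
    -- column N - α_j + 1, …, N and nowhere else
    once-in-range : ∀ j c → 1 ≤ j → j ≤ n →
      maxEntry α ∸ at α j < c → c ≤ maxEntry α →
      ∃[ r ] (T r c ≡ ● × τ r c ≡ j ×
              (∀ r′ → T r′ c ≡ ● → τ r′ c ≡ j → r′ ≡ r))
    none-outside : ∀ j c → ¬ (maxEntry α ∸ at α j < c × c ≤ maxEntry α) →
      ∀ r → T r c ≡ ● → τ r c ≢ j
    row-bound : ∀ r c → T r c ≡ ● → r ≤ τ r c
    weakly-descend : ∀ r₁ c₁ r₂ c₂ → T r₁ c₁ ≡ ● → T r₂ c₂ ≡ ● →
      τ r₁ c₁ ≡ τ r₂ c₂ → c₁ < c₂ → r₂ ≤ r₁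
    column-strict : ∀ r₁ r₂ c → T r₁ c ≡ ● → T r₂ c ≡ ● →
      r₁ < r₂ → τ r₁ c < τ r₂ c

-- L T τ r c = τ r* c for r* ≤ r maximal (r* ≥ 1) with (r*,c) ordinary
-- in T (0 if there is none).  For an ordinary cell this is τ r c; for a
-- ghost cell it is the label defined in the paper.
L : Diagram → Filling → ℕ → ℕ → ℕ
L T τ zero    c = 0
L T τ (suc r) c with T (suc r) c
... | ● = τ (suc r) c
... | ∅ = L T τ r c
... | ◌ = L T τ r c

{-# OPTIONS --safe #-}
-- In a lock tableau each column of ordinary cells carries exactly the rows of the same column
-- of the lock diagram D, increasing upwards. So every label, that of a ghost included, is
-- determined by the number of ordinary cells below it in its column, and (a)–(d) are the
-- tableau axioms. A moving cell never jumps over a ghost, so that number never changes below a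
-- ghost, which gives (e) and (f). Properties (g)–(i), phrased through these counts, are
-- invariants of K-Kohnert moves, together with a count form of the descent condition (iii); the
-- latter survives a move because the moved cell leaves the top of a block of ordinary cells
-- whose row is empty to its right.
module Submission where

open import Defs
open import Data.Bool using (Bool; true; false; _∧_; if_then_else_)
open import Data.Bool.Properties using (¬-not; ∧-identityʳ; ∧-zeroʳ)
open import Data.Empty using (⊥-elim)
open import Data.Nat
open import Data.Nat.Properties
open import Data.Nat.Solver using (module +-*-Solver)
open import Data.Product using (_×_; _,_; proj₁; proj₂; ∃-syntax)
open import Data.Sum using (_⊎_; inj₁; inj₂)
open import Data.Vec using (Vec)
open import Function using (_∘_)
open import Function.Bundles using (_⇔_; mk⇔; Equivalence)
open import Relation.Binary.Definitions using (tri<; tri≈; tri>)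
open import Relation.Binary.PropositionalEquality
open import Relation.Nullary using (¬_; yes; no; does; contradiction)
open import Relation.Nullary.Decidable using (dec-true; dec-false)
open import Relation.Nullary.Reflects using (Reflects; ofʸ; ofⁿ; _×-reflects_)
open import Algebra.Properties.CommutativeSemigroup +-commutativeSemigroup using (interchange)

bit : Bool → ℕ
bit true  = 1
bit false = 0

count : (ℕ → Bool) → ℕ → ℕ
count f zero    = 0
count f (suc m) = bit (f m) + count f m

module _ {f : ℕ → Bool} where

  count-true : ∀ {m} → f m ≡ true → count f (suc m) ≡ suc (count f m)
  count-true fm rewrite fm = refl

  count-false : ∀ {m} → f m ≡ false → count f (suc m) ≡ count f m
  count-false fm rewrite fm = refl

  count-mono : ∀ {m m′} → m ≤ m′ → count f m ≤ count f m′
  count-mono {m′ = zero}   z≤n = ≤-refl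
  count-mono {m′ = suc m′} m≤ with m≤n⇒m<n∨m≡n m≤
  ... | inj₁ m<1+m′ = ≤-trans (count-mono (≤-pred m<1+m′)) (m≤n+m _ (bit (f m′)))
  ... | inj₂ refl   = ≤-refl

  count-<⇒< : ∀ {a b} → count f a < count f b → a < b
  count-<⇒< {a} {b} lt with a <? b
  ... | yes a<b = a<b
  ... | no  a≮b = contradiction (count-mono (≮⇒≥ a≮b)) (<⇒≱ lt)

  count-≤⇒< : ∀ {a b} → f a ≡ true → count f (suc a) ≤ count f b → a < b
  count-≤⇒< fa le = count-<⇒< (<-≤-trans (≤-reflexive (sym (count-true fa))) le)

  count-injective : ∀ {a b} → f a ≡ true → f b ≡ true →
    count f (suc a) ≡ count f (suc b) → a ≡ b
  count-injective {a} {b} fa fb eq with <-cmp a b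
  ... | tri≈ _ a≡b _ = a≡b
  ... | tri< a<b _ _ = contradiction (≤-pred (count-≤⇒< fb (≤-reflexive (sym eq)))) (<⇒≱ a<b)
  ... | tri> _ _ b<a = contradiction (≤-pred (count-≤⇒< fa (≤-reflexive eq))) (<⇒≱ b<a)

  count-none : ∀ m → (∀ x → x < m → f x ≡ false) → count f m ≡ 0
  count-none zero    _    = refl
  count-none (suc m) none rewrite none m ≤-refl = count-none m (λ x x<m → none x (m<n⇒m<1+n x<m))

  count-unique : ∀ {p} B → p < B → f p ≡ true → (∀ x → f x ≡ true → x ≡ p) → count f B ≡ 1
  count-unique {p} (suc B) p<1+B fp unique with B ≟ p
  ... | yes refl rewrite fp = cong suc (count-none B (λ x x<B → ¬-not (λ fx → <⇒≢ x<B (unique x fx))))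
  ... | no  B≢p  rewrite ¬-not (λ fB → B≢p (unique B fB)) =
    count-unique B (≤∧≢⇒< (≤-pred p<1+B) (B≢p ∘ sym)) fp unique

  count-bounded : ∀ B → (∀ y → f y ≡ true → y < B) → ∀ x → count f x ≤ count f B
  count-bounded B bound zero    = z≤n
  count-bounded B bound (suc x) with f x in fx
  ... | true  = subst (_≤ count f B) (count-true fx) (count-mono (bound x fx))
  ... | false = count-bounded B bound x

  count-+-≤ : ∀ d a → count f (d + a) ≤ d + count f a
  count-+-≤ zero    a = ≤-refl
  count-+-≤ (suc d) a = +-mono-≤ (bit≤1 (f (d + a))) (count-+-≤ d a)
    where
    bit≤1 : ∀ b → bit b ≤ 1
    bit≤1 true  = ≤-refl
    bit≤1 false = z≤n

  count-full : ∀ d a → (∀ y → a ≤ y → y < d + a → f y ≡ true) → count f (d + a) ≡ d + count f a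
  count-full zero    a full = refl
  count-full (suc d) a full rewrite full (d + a) (m≤n+m a d) ≤-refl =
    cong suc (count-full d a (λ y a≤y y<d+a → full y a≤y (m<n⇒m<1+n y<d+a)))

  count-reaches : ∀ B k → 1 ≤ k → k ≤ count f B → ∃[ x ] (f x ≡ true × count f (suc x) ≡ k)
  count-reaches zero    k 1≤k k≤0 = contradiction k≤0 (<⇒≱ 1≤k)
  count-reaches (suc B) k 1≤k k≤ with k ≤? count f B
  ... | yes k≤B = count-reaches B k 1≤k k≤B
  ... | no  k≰B with f B in fB
  ...   | true  = B , fB , trans (count-true fB) (≤-antisym (≰⇒> k≰B) k≤)
  ...   | false = contradiction k≤ k≰B

count-cong : ∀ {f g} m → (∀ x → x < m → f x ≡ g x) → count f m ≡ count g m
count-cong zero    _   = refl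
count-cong (suc m) f≗g =
  cong₂ _+_ (cong bit (f≗g m ≤-refl)) (count-cong m (λ x x<m → f≗g x (m<n⇒m<1+n x<m)))

count-+ : ∀ {f g h} m → (∀ x → bit (f x) ≡ bit (g x) + bit (h x)) → count f m ≡ count g m + count h m
count-+ zero    _  = refl
count-+ {f} {g} {h} (suc m) pt rewrite pt m | count-+ m pt =
  interchange (bit (g m)) (bit (h m)) (count g m) (count h m)

-- #f[a, b) ≤ #g[a, b) for f ⊆ g, stated without subtraction.
count-⊆ : ∀ {f g} → (∀ x → f x ≡ true → g x ≡ true) → ∀ {a b} → a ≤ b →
  count f b + count g a ≤ count g b + count f a
count-⊆ {f} {g} f⊆g {a} a≤b with m≤n⇒∃[o]m+o≡n a≤b
... | d , refl rewrite +-comm a d = go d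
  where
  bit-mono : ∀ x → bit (f x) ≤ bit (g x)
  bit-mono x with f x in fx
  ... | false = z≤n
  ... | true rewrite f⊆g x fx = ≤-refl
  go : ∀ d → count f (d + a) + count g a ≤ count g (d + a) + count f a
  go zero    = ≤-reflexive (+-comm (count f a) (count g a))
  go (suc d) = begin
    (bit (f (d + a)) + count f (d + a)) + count g a ≡⟨ +-assoc (bit (f (d + a))) _ _ ⟩
    bit (f (d + a)) + (count f (d + a) + count g a) ≤⟨ +-mono-≤ (bit-mono (d + a)) (go d) ⟩
    bit (g (d + a)) + (count g (d + a) + count f a) ≡⟨ +-assoc (bit (g (d + a))) _ _ ⟨
    (bit (g (d + a)) + count g (d + a)) + count f a ∎
    where open ≤-Reasoning

count-restrict : ∀ {P q} B → q ≤ B → count (λ p → P p ∧ does (p <? q)) B ≡ count P q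
count-restrict zero    z≤n = refl
count-restrict {P} (suc B) q≤1+B with m≤n⇒m<n∨m≡n q≤1+B
... | inj₂ refl =
  count-cong (suc B) (λ x x<q → trans (cong (P x ∧_) (dec-true (x <? suc B) x<q)) (∧-identityʳ (P x)))
... | inj₁ q<1+B rewrite dec-false (B <? _) (≤⇒≯ (≤-pred q<1+B)) | ∧-zeroʳ (P B) =
  count-restrict B (≤-pred q<1+B)

-- Double counting the points of P below B by their σ-value.
count-by-value : ∀ {P : ℕ → Bool} {σ : ℕ → ℕ} {S : ℕ → Bool} B →
  (∀ v → count (λ p → P p ∧ does (σ p ≟ v)) B ≡ bit (S v)) →
  ∀ v → count S v ≡ count (λ p → P p ∧ does (σ p <? v)) B
count-by-value {P} {σ} B fibre zero =
  sym (count-none B (λ p _ → trans (cong (P p ∧_) (dec-false (σ p <? 0) λ ())) (∧-zeroʳ (P p))))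
count-by-value {P} {σ} {S} B fibre (suc v) = begin
  bit (S v) + count S v
    ≡⟨ cong₂ _+_ (sym (fibre v)) (count-by-value B fibre v) ⟩
  count (λ p → P p ∧ does (σ p ≟ v)) B + count (λ p → P p ∧ does (σ p <? v)) B
    ≡⟨ count-+ B split ⟨
  count (λ p → P p ∧ does (σ p <? suc v)) B ∎
  where
  open ≡-Reasoning
  split : ∀ p →
    bit (P p ∧ does (σ p <? suc v)) ≡ bit (P p ∧ does (σ p ≟ v)) + bit (P p ∧ does (σ p <? v))
  split p with P p | <-cmp (σ p) v
  ... | false | _ = refl
  ... | true | tri< σ<v σ≢v _
    rewrite dec-true (σ p <? suc v) (m<n⇒m<1+n σ<v) | dec-false (σ p ≟ v) σ≢v | dec-true (σ p <? v) σ<v = refl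
  ... | true | tri≈ σ≮v refl _
    rewrite dec-true (σ p <? suc v) ≤-refl | dec-true (σ p ≟ v) refl | dec-false (σ p <? v) σ≮v = refl
  ... | true | tri> σ≮v σ≢v v<σ
    rewrite dec-false (σ p <? suc v) (<⇒≱ v<σ ∘ ≤-pred) | dec-false (σ p ≟ v) σ≢v | dec-false (σ p <? v) σ≮v = refl

count-below-monotone : ∀ {P : ℕ → Bool} {σ : ℕ → ℕ} B →
  (∀ {p q} → P p ≡ true → P q ≡ true → p < q → σ p < σ q) →
  ∀ {q} → P q ≡ true → q ≤ B → count (λ p → P p ∧ does (σ p <? σ q)) B ≡ count P q
count-below-monotone {P} {σ} B strict {q} Pq q≤B =
  trans (count-cong B (λ p _ → same p)) (count-restrict B q≤B)
  where
  same : ∀ p → P p ∧ does (σ p <? σ q) ≡ P p ∧ does (p <? q)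
  same p with P p in Pp | <-cmp p q
  ... | false | _ = refl
  ... | true | tri< p<q _ _
    rewrite dec-true (σ p <? σ q) (strict Pp Pq p<q) | dec-true (p <? q) p<q = refl
  ... | true | tri≈ p≮q refl _
    rewrite dec-false (σ p <? σ p) (<-irrefl refl) | dec-false (p <? p) p≮q = refl
  ... | true | tri> p≮q _ q<p
    rewrite dec-false (σ p <? σ q) (<⇒≯ (strict Pq Pp q<p)) | dec-false (p <? q) p≮q = refl

isOrdinary : Cell → Bool
isOrdinary ● = true
isOrdinary ∅ = false
isOrdinary ◌ = false

isOrdinary⇒● : ∀ {x} → isOrdinary x ≡ true → x ≡ ●
isOrdinary⇒● {●} _ = refl

column : Diagram → ℕ → ℕ → Bool
column U c q = isOrdinary (U q c)

-- #● U c q is the number of ordinary cells of U in column c strictly below row q.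
#● : Diagram → ℕ → ℕ → ℕ
#● U c = count (column U c)

column-false : ∀ {U q c} → U q c ≢ ● → column U c q ≡ false
column-false ¬● = ¬-not (¬● ∘ isOrdinary⇒●)

#●-● : ∀ U {q c} → U q c ≡ ● → #● U c (suc q) ≡ suc (#● U c q)
#●-● U {q} {c} Uq = count-true {column U c} {q} (cong isOrdinary Uq)

#●-≢● : ∀ U {q c} → U q c ≢ ● → #● U c (suc q) ≡ #● U c q
#●-≢● U {q} {c} ¬● = count-false {column U c} {q} (column-false {U} ¬●)

#●-∅ : ∀ U {q c} → U q c ≡ ∅ → #● U c (suc q) ≡ #● U c q
#●-∅ U {q} {c} Uq = count-false {column U c} {q} (cong isOrdinary Uq)

#●-◌ : ∀ U {q c} → U q c ≡ ◌ → #● U c (suc q) ≡ #● U c q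
#●-◌ U {q} {c} Uq = count-false {column U c} {q} (cong isOrdinary Uq)

-- Kohnert and ghost moves act identically on ordinary cells.
record Move (U V : Diagram) (r c r̂ : ℕ) : Set where
  field
    pre     : MovePre U r c r̂
    new     : V r̂ c ≡ ●
    vacated : V r c ≢ ●
    other   : ∀ p q → ¬ (p ≡ r̂ × q ≡ c) → ¬ (p ≡ r × q ≡ c) → V p q ≡ U p q
  open MovePre pre public

ghostMove⇒Move : ∀ {U V r c r̂} → GhostMove U V r c r̂ → Move U V r c r̂
ghostMove⇒Move g = record
  { pre = pre ; new = new ; vacated = λ V● → contradiction (trans (sym old) V●) λ () ; other = other }
  where open GhostMove g

kkStep⇒Move : ∀ {U V} → KKStep U V → ∃[ r ] ∃[ c ] ∃[ r̂ ] Move U V r c r̂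
kkStep⇒Move (kohnert r c r̂ k) = r , c , r̂ , record
  { pre = pre ; new = new ; vacated = λ V● → contradiction (trans (sym old) V●) λ () ; other = other }
  where open KohnertMove k
kkStep⇒Move (ghost r c r̂ g) = r , c , r̂ , ghostMove⇒Move g

module MoveProperties {U V : Diagram} {r m r̂ : ℕ} (mv : Move U V r m r̂) where

  open Move mv

  same-column : ∀ {c} → c ≢ m → ∀ p → V p c ≡ U p c
  same-column c≢m p = other p _ (c≢m ∘ proj₂) (c≢m ∘ proj₂)

  same-row : ∀ {p} → p ≢ r̂ → p ≢ r → V p m ≡ U p m
  same-row p≢r̂ p≢r = other _ m (p≢r̂ ∘ proj₁) (p≢r ∘ proj₁)

  #●-other-column : ∀ {c} → c ≢ m → ∀ x → #● V c x ≡ #● U c x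
  #●-other-column c≢m x = count-cong x (λ p _ → cong isOrdinary (same-column c≢m p))

  #●-below : ∀ {x} → x ≤ r̂ → #● V m x ≡ #● U m x
  #●-below {x} x≤r̂ = count-cong x λ p p<x →
    let p<r̂ = <-≤-trans p<x x≤r̂ in cong isOrdinary (same-row (<⇒≢ p<r̂) (<⇒≢ (<-trans p<r̂ r̂<r)))

  #●-between : ∀ {x} → r̂ < x → x ≤ r → #● V m x ≡ suc (#● U m x)
  #●-between {suc x} r̂<1+x 1+x≤r with m≤n⇒m<n∨m≡n (≤-pred r̂<1+x)
  ... | inj₂ refl = begin
    #● V m (suc r̂)       ≡⟨ #●-● V new ⟩
    suc (#● V m r̂)       ≡⟨ cong suc (#●-below ≤-refl) ⟩
    suc (#● U m r̂)       ≡⟨ cong suc (#●-∅ U r̂-empty) ⟨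
    suc (#● U m (suc r̂)) ∎
    where open ≡-Reasoning
  ... | inj₁ r̂<x = trans (cong₂ _+_ (cong (bit ∘ isOrdinary) (same-row (>⇒≢ r̂<x) (<⇒≢ 1+x≤r)))
                                    (#●-between r̂<x (<⇒≤ 1+x≤r)))
                         (+-suc _ _)

  #●-above : ∀ {x} → r < x → #● V m x ≡ #● U m x
  #●-above {suc x} r<1+x with m≤n⇒m<n∨m≡n (≤-pred r<1+x)
  ... | inj₂ refl = begin
    #● V m (suc r)       ≡⟨ #●-≢● V vacated ⟩
    #● V m r             ≡⟨ #●-between r̂<r ≤-refl ⟩
    suc (#● U m r)       ≡⟨ #●-● U ordinary ⟨
    #● U m (suc r)       ∎
    where open ≡-Reasoning
  ... | inj₁ r<x = cong₂ _+_ (cong (bit ∘ isOrdinary) (same-row (>⇒≢ (<-trans r̂<r r<x)) (>⇒≢ r<x)))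
                             (#●-above r<x)

  #●-moved-column-mono : ∀ x → #● U m x ≤ #● V m x
  #●-moved-column-mono x with x ≤? r̂ | x ≤? r
  ... | yes x≤r̂ | _      = ≤-reflexive (sym (#●-below x≤r̂))
  ... | no  x≰r̂ | yes x≤r = ≤-trans (n≤1+n _) (≤-reflexive (sym (#●-between (≰⇒> x≰r̂) x≤r)))
  ... | no  _   | no x≰r  = ≤-reflexive (sym (#●-above (≰⇒> x≰r)))

  #●-block : ∀ {x} → r̂ < x → x ≤ r → #● U m (suc r) ≡ suc (r ∸ x) + #● U m x
  #●-block {x} r̂<x x≤r = begin
    #● U m (suc r)                   ≡⟨ cong (#● U m ∘ suc) (m∸n+n≡m x≤r) ⟨
    #● U m (suc (r ∸ x + x))         ≡⟨ count-full (suc (r ∸ x)) x full ⟩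
    suc (r ∸ x) + #● U m x           ∎
    where
    open ≡-Reasoning
    full : ∀ y → x ≤ y → y < suc (r ∸ x + x) → column U m y ≡ true
    full y x≤y y<1+r with y ≟ r
    ... | yes refl = cong isOrdinary ordinary
    ... | no  y≢r  = cong isOrdinary (between y (<-≤-trans r̂<x x≤y)
                       (≤∧≢⇒< (subst (y ≤_) (m∸n+n≡m x≤r) (≤-pred y<1+r)) y≢r))

  row₀-stays-empty : ∀ {c} → U 0 c ≡ ∅ → V 0 c ≡ ∅
  row₀-stays-empty U₀ = trans (other 0 _ (<⇒≢ r̂-pos ∘ proj₁) (<⇒≢ (<-trans r̂-pos r̂<r) ∘ proj₁)) U₀

  ghost-origin : ∀ {p c} → V p c ≡ ◌ → U p c ≡ ◌ ⊎ (p ≡ r × c ≡ m)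
  ghost-origin {p} {c} Vp with p ≟ r | c ≟ m
  ... | yes p≡r | yes c≡m = inj₂ (p≡r , c≡m)
  ... | _       | no c≢m  = inj₁ (trans (sym (same-column c≢m p)) Vp)
  ... | no p≢r  | yes refl with p ≟ r̂
  ...   | yes refl = contradiction (trans (sym new) Vp) λ ()
  ...   | no p≢r̂   = inj₁ (trans (sym (same-row p≢r̂ p≢r)) Vp)

  -- The moving cell cannot jump over a ghost (MovePre.between), so it stays on one side of it.
  ghost-stays : ∀ {p c} → U p c ≡ ◌ → V p c ≡ ◌ × #● V c p ≡ #● U c p
  ghost-stays {p} {c} Up with c ≟ m
  ... | no c≢m = trans (same-column c≢m p) Up , #●-other-column c≢m p
  ... | yes refl with <-cmp p r
  ...   | tri≈ _ refl _ = contradiction (trans (sym ordinary) Up) λ ()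
  ...   | tri> _ _ r<p  = trans (same-row (>⇒≢ (<-trans r̂<r r<p)) (>⇒≢ r<p)) Up , #●-above r<p
  ...   | tri< p<r _ _ with r̂ <? p
  ...     | yes r̂<p = contradiction (trans (sym (between p r̂<p p<r)) Up) λ ()
  ...     | no  r̂≮p with p ≟ r̂
  ...       | yes refl = contradiction (trans (sym r̂-empty) Up) λ ()
  ...       | no  p≢r̂  = trans (same-row p≢r̂ (<⇒≢ p<r)) Up , #●-below (≮⇒≥ r̂≮p)

ghost-stays* : ∀ {T T̃ p c} → Reach KKStep T T̃ → T p c ≡ ◌ →
  T̃ p c ≡ ◌ × #● T̃ c p ≡ #● T c p
ghost-stays* {p = p} {c} (here T̃≗T) Tp =
  trans (T̃≗T p c) Tp , count-cong p (λ y _ → cong isOrdinary (T̃≗T y c))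
ghost-stays* (step T→U st) Tp with ghost-stays* T→U Tp | kkStep⇒Move st
... | Up , same | _ , _ , _ , mv with MoveProperties.ghost-stays mv Up
...   | Vp , same′ = Vp , trans same′ same

if-●⇔ : ∀ {A : Set} {b} → Reflects A b → (if b then ● else ∅) ≡ ● ⇔ A
if-●⇔ (ofʸ a)  = mk⇔ (λ _ → a) (λ _ → refl)
if-●⇔ (ofⁿ ¬a) = mk⇔ (λ ()) (λ a → contradiction a ¬a)

if-●≢◌ : ∀ b → (if b then ● else ∅) ≢ ◌
if-●≢◌ true  ()
if-●≢◌ false ()

-- D is a variable standing for lockDiagram α, so that unification never unfolds lockDiagram.
module Lock {n} (α : Vec ℕ n) {D : Diagram} (isLock : D ≗D lockDiagram α) where

  open Equivalence using (to; from)

  N : ℕ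
  N = maxEntry α

  InLock : ℕ → ℕ → Set
  InLock j c = 1 ≤ j × j ≤ n × N ∸ at α j < c × c ≤ N

  lock-● : ∀ {j c} → D j c ≡ ● ⇔ InLock j c
  lock-● {j} {c} = mk⇔ (to spec ∘ trans (sym (isLock j c))) (trans (isLock j c) ∘ from spec)
    where
    spec = if-●⇔ (≤ᵇ-reflects-≤ 1 j ×-reflects ≤ᵇ-reflects-≤ j n
                  ×-reflects <ᵇ-reflects-< (N ∸ at α j) c ×-reflects ≤ᵇ-reflects-≤ c N)

  lock-no-ghost : ∀ {j c} → D j c ≢ ◌
  lock-no-ghost {j} {c} = if-●≢◌ ((1 ≤ᵇ j) ∧ (j ≤ᵇ n) ∧ (N ∸ at α j <ᵇ c) ∧ (c ≤ᵇ N))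
                        ∘ trans (sym (isLock j c))

  lock-row≤n : ∀ {j c} → D j c ≡ ● → j ≤ n
  lock-row≤n Dj = to lock-● Dj .proj₂ .proj₁

  lock-column≤N : ∀ {j c} → D j c ≡ ● → c ≤ N
  lock-column≤N Dj = to lock-● Dj .proj₂ .proj₂ .proj₂

  lock-nested : ∀ {j c c′} → D j c ≡ ● → c ≤ c′ → c′ ≤ N → D j c′ ≡ ●
  lock-nested Dj c≤c′ c′≤N with to lock-● Dj
  ... | 1≤j , j≤n , lo , _ = from lock-● (1≤j , j≤n , <-≤-trans lo c≤c′ , c′≤N)

  -- v is the label that the ordinary cells of U in column c below row r assign
  -- to row r: the (#● U c r)-th smallest row of column c of D.
  record IsLabel (U : Diagram) (r c v : ℕ) : Set where
    constructor isLabel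
    field
      lock-cell : D v c ≡ ●
      rank      : #● D c (suc v) ≡ #● U c r

  IsLabel-cong : ∀ {U U′ r r′ c v} → #● U c r ≡ #● U′ c r′ →
    IsLabel U r c v → IsLabel U′ r′ c v
  IsLabel-cong eq (isLabel Dv rank) = isLabel Dv (trans rank eq)

  IsLabel-unique : ∀ {U U′ r r′ c v v′} → IsLabel U r c v → IsLabel U′ r′ c v′ →
    #● U c r ≡ #● U′ c r′ → v ≡ v′
  IsLabel-unique (isLabel Dv rank) (isLabel Dv′ rank′) eq =
    count-injective (cong isOrdinary Dv) (cong isOrdinary Dv′) (trans rank (trans eq (sym rank′)))

  L-no-cell-below : ∀ {A σ c} m → #● A c (suc m) ≡ 0 → L A σ m c ≡ 0
  L-no-cell-below zero    _ = refl
  L-no-cell-below {A} {c = c} (suc m) none with A (suc m) c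
  ... | ∅ = L-no-cell-below m none
  ... | ◌ = L-no-cell-below m none

  module Tableau {A : Diagram} {σ : Filling} (tab : IsLockTableau α A σ) where

    open IsLockTableau tab

    entry∈column : ∀ {p c} → A p c ≡ ● → D (σ p c) c ≡ ●
    entry∈column {p} {c} Ap with N ∸ at α (σ p c) <? c | c ≤? N
    ... | yes lo  | yes hi = from lock-● (entry-range p c Ap .proj₁ , entry-range p c Ap .proj₂ , lo , hi)
    ... | no  ¬lo | _      = contradiction refl (none-outside (σ p c) c (¬lo ∘ proj₁) p Ap)
    ... | yes _   | no ¬hi = contradiction refl (none-outside (σ p c) c (¬hi ∘ proj₂) p Ap)

    row≤n : ∀ {p c} → A p c ≡ ● → p ≤ n
    row≤n {p} {c} Ap = ≤-trans (row-bound p c Ap) (entry-range p c Ap .proj₂)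

    fibre : ℕ → ℕ → ℕ → Bool
    fibre c v p = column A c p ∧ does (σ p c ≟ v)

    fibre-unique : ∀ {c v} → InLock v c → count (fibre c v) (suc n) ≡ 1
    fibre-unique {c} {v} (1≤v , v≤n , lo , hi) with once-in-range v c 1≤v v≤n lo hi
    ... | r , Ar , σr , unique = count-unique (suc n) (s≤s (row≤n Ar)) hit only
      where
      hit : fibre c v r ≡ true
      hit rewrite Ar = dec-true (σ r c ≟ v) σr
      only : ∀ x → fibre c v x ≡ true → x ≡ r
      only x h with A x c in Ax | σ x c ≟ v
      ... | ● | yes σx  = unique x Ax σx
      ... | ● | no σx≢v = contradiction (trans (sym h) (dec-false (σ x c ≟ v) σx≢v)) λ ()
      ... | ∅ | _       = contradiction h λ ()
      ... | ◌ | _       = contradiction h λ ()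

    fibre-empty : ∀ {c v} → column D c v ≡ false → ∀ p → fibre c v p ≡ false
    fibre-empty {c} {v} Dv p with A p c in Ap | σ p c ≟ v
    ... | ● | yes refl = contradiction (trans (sym (cong isOrdinary (entry∈column Ap))) Dv) λ ()
    ... | ● | no σp≢v  = dec-false (σ p c ≟ v) σp≢v
    ... | ∅ | _        = refl
    ... | ◌ | _        = refl

    fibre-size : ∀ c v → count (fibre c v) (suc n) ≡ bit (column D c v)
    fibre-size c v with column D c v in Dv
    ... | true  = fibre-unique (to lock-● (isOrdinary⇒● Dv))
    ... | false = count-none (suc n) (λ p _ → fibre-empty Dv p)

    #●-entry : ∀ {q c} → A q c ≡ ● → #● A c q ≡ #● D c (σ q c)
    #●-entry {q} {c} Aq = begin
      #● A c q
        ≡⟨ count-below-monotone (suc n) strict (cong isOrdinary Aq) (<⇒≤ (s≤s (row≤n Aq))) ⟨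
      count (λ p → column A c p ∧ does (σ p c <? σ q c)) (suc n)
        ≡⟨ count-by-value (suc n) (fibre-size c) (σ q c) ⟨
      #● D c (σ q c) ∎
      where
      open ≡-Reasoning
      strict : ∀ {p p′} → column A c p ≡ true → column A c p′ ≡ true → p < p′ → σ p c < σ p′ c
      strict Ap Ap′ = column-strict _ _ c (isOrdinary⇒● Ap) (isOrdinary⇒● Ap′)

    module _ (row₀-empty : ∀ c → A 0 c ≡ ∅) where

      L-ordinary : ∀ {r c} → A r c ≡ ● → L A σ r c ≡ σ r c
      L-ordinary {zero}  {c} Ar = contradiction (trans (sym (row₀-empty c)) Ar) λ ()
      L-ordinary {suc r}     Ar rewrite Ar = refl

      L-IsLabel : ∀ m c → 1 ≤ #● A c (suc m) → IsLabel A (suc m) c (L A σ m c)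
      L-IsLabel zero    c 1≤ rewrite row₀-empty c = contradiction 1≤ λ ()
      L-IsLabel (suc m) c 1≤ with A (suc m) c in Am
      ... | ∅ = IsLabel-cong (sym (#●-∅ A Am)) (L-IsLabel m c 1≤)
      ... | ◌ = IsLabel-cong (sym (#●-◌ A Am)) (L-IsLabel m c 1≤)
      ... | ● = isLabel (entry∈column Am) (begin
        #● D c (suc (σ (suc m) c)) ≡⟨ #●-● D (entry∈column Am) ⟩
        suc (#● D c (σ (suc m) c)) ≡⟨ cong suc (#●-entry Am) ⟨
        suc (#● A c (suc m))       ≡⟨ #●-● A Am ⟨
        #● A c (suc (suc m))       ∎)
        where open ≡-Reasoning

      lock-column-labels : ∀ c x → (D x c ≡ ●) ⇔ (∃[ r ] (A r c ≡ ● × L A σ r c ≡ x))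
      lock-column-labels c x = mk⇔ ⇒ ⇐
        where
        ⇒ : D x c ≡ ● → ∃[ r ] (A r c ≡ ● × L A σ r c ≡ x)
        ⇒ Dx with to lock-● Dx
        ... | 1≤x , x≤n , lo , hi with once-in-range x c 1≤x x≤n lo hi
        ...   | r , Ar , σr , _ = r , Ar , trans (L-ordinary Ar) σr
        ⇐ : ∃[ r ] (A r c ≡ ● × L A σ r c ≡ x) → D x c ≡ ●
        ⇐ (r , Ar , Lr) = subst (λ v → D v c ≡ ●) (trans (sym (L-ordinary Ar)) Lr) (entry∈column Ar)

      row≤L : ∀ r c → A r c ≡ ● → r ≤ L A σ r c
      row≤L r c Ar = subst (r ≤_) (sym (L-ordinary Ar)) (row-bound r c Ar)

      L-column-strict : ∀ r₁ r₂ c → A r₁ c ≡ ● → A r₂ c ≡ ● → r₁ < r₂ →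
        L A σ r₁ c < L A σ r₂ c
      L-column-strict r₁ r₂ c A₁ A₂ r₁<r₂ rewrite L-ordinary A₁ | L-ordinary A₂ =
        column-strict r₁ r₂ c A₁ A₂ r₁<r₂

      L-equal-labels : ∀ r₁ c₁ r₂ c₂ → A r₁ c₁ ≡ ● → A r₂ c₂ ≡ ● → ¬ (r₁ ≡ r₂ × c₁ ≡ c₂) →
        L A σ r₁ c₁ ≡ L A σ r₂ c₂ → c₁ ≢ c₂ × (c₁ < c₂ → r₂ ≤ r₁)
      L-equal-labels r₁ c₁ r₂ c₂ A₁ A₂ distinct eq rewrite L-ordinary A₁ | L-ordinary A₂ =
        c₁≢c₂ , weakly-descend r₁ c₁ r₂ c₂ A₁ A₂ eq
        where
        c₁≢c₂ : c₁ ≢ c₂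
        c₁≢c₂ refl with <-cmp r₁ r₂
        ... | tri< r₁<r₂ _ _ = <-irrefl eq (column-strict r₁ r₂ c₁ A₁ A₂ r₁<r₂)
        ... | tri≈ _ r₁≡r₂ _ = distinct (r₁≡r₂ , refl)
        ... | tri> _ _ r₂<r₁ = <-irrefl (sym eq) (column-strict r₂ r₁ c₁ A₂ A₁ r₂<r₁)

  L-determined : ∀ {A σ B β} → IsLockTableau α A σ → IsLockTableau α B β →
    (∀ c → A 0 c ≡ ∅) → (∀ c → B 0 c ≡ ∅) →
    ∀ {m m′ c} → #● A c (suc m) ≡ #● B c (suc m′) → L A σ m c ≡ L B β m′ c
  L-determined {A} tabA tabB row₀A row₀B {m} {m′} {c} eq with #● A c (suc m) in eqA
  ... | zero  = trans (L-no-cell-below m eqA) (sym (L-no-cell-below m′ (sym eq)))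
  ... | suc _ = IsLabel-unique
    (Tableau.L-IsLabel tabA row₀A m c (≤-trans (s≤s z≤n) (≤-reflexive (sym eqA))))
    (Tableau.L-IsLabel tabB row₀B m′ c (≤-trans (s≤s z≤n) (≤-reflexive eq)))
    (trans eqA eq)

module Reachable {n} (α : Vec ℕ n) {D : Diagram} (isLock : D ≗D lockDiagram α) where

  open Lock α isLock

  -- By #●-entry the cell labelled j in column c of a lock tableau lies in a row < x iff
  -- #● D c (suc j) ≤ #● U c x, so this is the count form of condition (iii).
  LabelsDescend : Diagram → Set
  LabelsDescend U = ∀ {c c′} → c < c′ → ∀ {j} x → D j c ≡ ● →
    #● D c (suc j) ≤ #● U c x → #● D c′ (suc j) ≤ #● U c′ x

  -- The last three fields are (g), (h), (i); the others are what makes them survive a move.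
  record Invariant (U : Diagram) : Set where
    field
      row₀-empty           : ∀ c → U 0 c ≡ ∅
      lowered              : ∀ c x → #● D c x ≤ #● U c x
      bounded              : ∀ c x → #● U c x ≤ #● D c (suc n)
      descending           : LabelsDescend U
      ghost-raised         : ∀ {r c} → U r c ≡ ◌ → #● D c r < #● U c r
      ghost-row-increasing : ∀ {r c₁ c₂ v₁ v₂} → U r c₁ ≡ ◌ → U r c₂ ≡ ◌ → c₁ < c₂ →
                             IsLabel U r c₁ v₁ → IsLabel U r c₂ v₂ → v₁ < v₂
      ghost-row-step       : ∀ {r c₁ c₂ v₁ v₂} → U r c₁ ≡ ◌ → U (suc r) c₂ ≡ ◌ →
                             IsLabel U r c₁ v₁ → IsLabel U (suc r) c₂ v₂ → v₁ < v₂ → c₁ < c₂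

  invariant-lock : ∀ {T} → T ≗D D → Invariant T
  invariant-lock {T} T≗D = record
    { row₀-empty           = λ c → trans (T≗D 0 c) (isLock 0 c)
    ; lowered              = λ c x → ≤-reflexive (sym (same c x))
    ; bounded              = λ c x → subst (_≤ _) (sym (same c x))
                               (count-bounded (suc n) (λ y Dy → s≤s (lock-row≤n (isOrdinary⇒● Dy))) x)
    ; descending           = descending-lock
    ; ghost-raised         = ⊥-elim ∘ no-ghost
    ; ghost-row-increasing = λ T₁ → ⊥-elim (no-ghost T₁)
    ; ghost-row-step       = λ T₁ → ⊥-elim (no-ghost T₁)
    }
    where
    same : ∀ c x → #● T c x ≡ #● D c x
    same c x = count-cong x (λ y _ → cong isOrdinary (T≗D y c))
    no-ghost : ∀ {r c} → T r c ≢ ◌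
    no-ghost {r} {c} = lock-no-ghost ∘ trans (sym (T≗D r c))
    descending-lock : LabelsDescend T
    descending-lock {c} {c′} _ x Dj h rewrite same c x | same c′ x =
      count-mono (count-≤⇒< {column D c} {b = x} (cong isOrdinary Dj) h)

  module Preservation {U V : Diagram} {r m r̂ : ℕ} (I : Invariant U) (mv : Move U V r m r̂) where

    open Invariant I
    open Move mv
    open MoveProperties mv
    open IsLabel

    label-stays : ∀ {p c v} → U p c ≡ ◌ → IsLabel V p c v → IsLabel U p c v
    label-stays Up = IsLabel-cong (ghost-stays Up .proj₂)

    ghost-left-of-new : ∀ {c v₁ v₂} → c < m → IsLabel U r c v₁ → IsLabel V r m v₂ → v₁ < v₂
    ghost-left-of-new {c} {v₁} {v₂} c<m l₁ l₂ =
      ≤-pred (count-<⇒< {column D m} (begin-strict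
      #● D m (suc v₁) ≤⟨ descending c<m r (lock-cell l₁) (≤-reflexive (rank l₁)) ⟩
      #● U m r        <⟨ ≤-refl ⟩
      suc (#● U m r)  ≡⟨ #●-between r̂<r ≤-refl ⟨
      #● V m r        ≡⟨ rank l₂ ⟨
      #● D m (suc v₂) ∎))
      where open ≤-Reasoning

    new-ghost-below : ∀ {c v₁ v₂} → c < m → IsLabel V r m v₁ → IsLabel U (suc r) c v₂ → v₂ ≤ v₁
    new-ghost-below {c} {v₁} {v₂} c<m l₁ l₂ =
      ≤-pred (count-≤⇒< {column D m} (cong isOrdinary v₂∈m) (begin
      #● D m (suc v₂) ≤⟨ descending c<m (suc r) (lock-cell l₂) (≤-reflexive (rank l₂)) ⟩
      #● U m (suc r)  ≡⟨ #●-● U ordinary ⟩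
      suc (#● U m r)  ≡⟨ #●-between r̂<r ≤-refl ⟨
      #● V m r        ≡⟨ rank l₁ ⟨
      #● D m (suc v₁) ∎))
      where
      open ≤-Reasoning
      v₂∈m : D v₂ m ≡ ●
      v₂∈m = lock-nested (lock-cell l₂) (<⇒≤ c<m) (lock-column≤N (lock-cell l₁))

    new-ghost-above : ∀ {p c v₁ v₂} → suc p ≡ r → m < c → U p c ≡ ◌ →
      IsLabel U p c v₁ → IsLabel V r m v₂ → v₂ ≤ v₁
    new-ghost-above {p} {c} {v₁} {v₂} 1+p≡r m<c Up l₁ l₂ =
      ≤-pred (count-≤⇒< {column D c} (cong isOrdinary v₂∈c) (begin
      #● D c (suc v₂) ≤⟨ descending m<c (suc r) (lock-cell l₂) (≤-reflexive below-r) ⟩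
      #● U c (suc r)  ≡⟨ #●-∅ U (rightmost c m<c) ⟩
      #● U c r        ≡⟨ cong (#● U c) 1+p≡r ⟨
      #● U c (suc p)  ≡⟨ #●-◌ U Up ⟩
      #● U c p        ≡⟨ rank l₁ ⟨
      #● D c (suc v₁) ∎))
      where
      open ≤-Reasoning
      v₂∈c : D v₂ c ≡ ●
      v₂∈c = lock-nested (lock-cell l₂) (<⇒≤ m<c) (lock-column≤N (lock-cell l₁))
      below-r : #● D m (suc v₂) ≡ #● U m (suc r)
      below-r = trans (rank l₂) (trans (#●-between r̂<r ≤-refl) (sym (#●-● U ordinary)))

    lowered′ : ∀ c x → #● D c x ≤ #● V c x
    lowered′ c x with c ≟ m
    ... | yes refl = ≤-trans (lowered c x) (#●-moved-column-mono x)
    ... | no  c≢m  = subst (_ ≤_) (sym (#●-other-column c≢m x)) (lowered c x)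

    bounded′ : ∀ c x → #● V c x ≤ #● D c (suc n)
    bounded′ c x with c ≟ m
    ... | no  c≢m  = subst (_≤ _) (sym (#●-other-column c≢m x)) (bounded c x)
    ... | yes refl = ≤-trans (count-mono (m≤m⊔n x (suc r)))
                       (subst (_≤ _) (sym (#●-above (m≤n⊔m x (suc r)))) (bounded c (x ⊔ suc r)))

    ghost-raised′ : ∀ {p c} → V p c ≡ ◌ → #● D c p < #● V c p
    ghost-raised′ {p} {c} Vp with ghost-origin Vp
    ... | inj₁ Up          = subst (_ <_) (sym (ghost-stays Up .proj₂)) (ghost-raised Up)
    ... | inj₂ (refl , refl) = <-≤-trans (s≤s (lowered m r)) (≤-reflexive (sym (#●-between r̂<r ≤-refl)))

    ghost-row-increasing′ : ∀ {p c₁ c₂ v₁ v₂} → V p c₁ ≡ ◌ → V p c₂ ≡ ◌ → c₁ < c₂ →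
      IsLabel V p c₁ v₁ → IsLabel V p c₂ v₂ → v₁ < v₂
    ghost-row-increasing′ V₁ V₂ c₁<c₂ l₁ l₂ with ghost-origin V₁ | ghost-origin V₂
    ... | inj₁ U₁ | inj₁ U₂ =
      ghost-row-increasing U₁ U₂ c₁<c₂ (label-stays U₁ l₁) (label-stays U₂ l₂)
    ... | inj₁ U₁ | inj₂ (refl , refl) = ghost-left-of-new c₁<c₂ (label-stays U₁ l₁) l₂
    ... | inj₂ (refl , refl) | inj₁ U₂ = contradiction (trans (sym (rightmost _ c₁<c₂)) U₂) λ ()
    ... | inj₂ (refl , refl) | inj₂ (_ , refl) = contradiction c₁<c₂ (<-irrefl refl)

    ghost-row-step′ : ∀ {p c₁ c₂ v₁ v₂} → V p c₁ ≡ ◌ → V (suc p) c₂ ≡ ◌ →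
      IsLabel V p c₁ v₁ → IsLabel V (suc p) c₂ v₂ → v₁ < v₂ → c₁ < c₂
    ghost-row-step′ {p} {c₁} {c₂} V₁ V₂ l₁ l₂ v₁<v₂ with <-cmp c₁ c₂
    ... | tri< c₁<c₂ _ _ = c₁<c₂
    ... | tri≈ _ refl _  = contradiction (IsLabel-unique l₁ l₂ (sym (#●-◌ V V₁))) (<⇒≢ v₁<v₂)
    ... | tri> _ _ c₂<c₁ with ghost-origin V₁ | ghost-origin V₂
    ...   | inj₁ U₁ | inj₁ U₂ =
      ghost-row-step U₁ U₂ (label-stays U₁ l₁) (label-stays U₂ l₂) v₁<v₂
    ...   | inj₂ (refl , _) | inj₂ (1+p≡p , _) = contradiction 1+p≡p 1+n≢n
    ...   | inj₂ (refl , refl) | inj₁ U₂ =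
      contradiction (new-ghost-below c₂<c₁ l₁ (label-stays U₂ l₂)) (<⇒≱ v₁<v₂)
    ...   | inj₁ U₁ | inj₂ (1+p≡r , refl) =
      contradiction (new-ghost-above 1+p≡r c₂<c₁ U₁ (label-stays U₁ l₁) (IsLabel-cong (cong (#● V c₂) 1+p≡r) l₂))
        (<⇒≱ v₁<v₂)

    -- Rows x, …, r of column m are ordinary in U. The label j* of row r there is at least j,
    -- lies below row r in column c′ (as U r c′ is empty), and between j and j* column c′ of D
    -- contains column m of D.
    past-moved-cell : ∀ {c′ x j} → m < c′ → c′ ≤ N → r̂ < x → x ≤ r → D j m ≡ ● →
      #● D m (suc j) ≤ suc (#● U m x) → #● D c′ (suc j) ≤ #● U c′ x
    past-moved-cell {c′} {x} {j} m<c′ c′≤N r̂<x x≤r Dj h = cancel (begin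
      suc d + K + A        ≡⟨ cong (_+ A) top ⟩
      #● D m (suc j*) + A  ≤⟨ count-⊆ m⊆c′ (s≤s j≤j*) ⟩
      #● D c′ (suc j*) + G ≤⟨ +-monoˡ-≤ G j*-in-c′ ⟩
      d + C + G            ∎) h
      where
      open ≤-Reasoning
      d = r ∸ x
      K = #● U m x
      A = #● D c′ (suc j)
      C = #● U c′ x
      G = #● D m (suc j)
      reached : ∃[ j* ] (column D m j* ≡ true × #● D m (suc j*) ≡ #● U m (suc r))
      reached = count-reaches (suc n) (#● U m (suc r))
                  (subst (1 ≤_) (sym (#●-● U ordinary)) (s≤s z≤n)) (bounded m (suc r))
      j* = proj₁ reached
      top : suc d + K ≡ #● D m (suc j*)
      top = trans (sym (#●-block r̂<x x≤r)) (sym (reached .proj₂ .proj₂))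
      j≤j* : j ≤ j*
      j≤j* = ≤-pred (count-≤⇒< {column D m} (cong isOrdinary Dj)
               (≤-trans h (≤-trans (s≤s (m≤n+m K d)) (≤-reflexive top))))
      m⊆c′ : ∀ y → column D m y ≡ true → column D c′ y ≡ true
      m⊆c′ y Dy = cong isOrdinary (lock-nested (isOrdinary⇒● Dy) (<⇒≤ m<c′) c′≤N)
      j*-in-c′ : #● D c′ (suc j*) ≤ d + C
      j*-in-c′ = begin
        #● D c′ (suc j*) ≤⟨ descending m<c′ (suc r) (isOrdinary⇒● (reached .proj₂ .proj₁))
                                                    (≤-reflexive (reached .proj₂ .proj₂)) ⟩
        #● U c′ (suc r)  ≡⟨ #●-∅ U (rightmost c′ m<c′) ⟩
        #● U c′ r        ≡⟨ cong (#● U c′) (m∸n+n≡m x≤r) ⟨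
        #● U c′ (d + x)  ≤⟨ count-+-≤ d x ⟩
        d + C            ∎
      cancel : suc d + K + A ≤ d + C + G → G ≤ suc K → A ≤ C
      cancel le G≤1+K = +-cancelˡ-≤ (suc d + K) A C
        (≤-trans le (≤-trans (+-monoʳ-≤ (d + C) G≤1+K) (≤-reflexive (shuffle d C K))))
        where
        open +-*-Solver
        shuffle : ∀ d C K → d + C + suc K ≡ suc d + K + C
        shuffle = solve 3 (λ d C K → d :+ C :+ (con 1 :+ K) := con 1 :+ d :+ K :+ C) refl

    from-moved-column : ∀ {c′ j} → m < c′ → ∀ x → D j m ≡ ● →
      #● D m (suc j) ≤ #● V m x → #● D c′ (suc j) ≤ #● U c′ x
    from-moved-column {c′} {j} m<c′ x Dj h with x ≤? r̂ | x ≤? r | c′ ≤? N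
    ... | yes x≤r̂ | _       | _        = descending m<c′ x Dj (subst (_ ≤_) (#●-below x≤r̂) h)
    ... | no  _   | no x≰r  | _        = descending m<c′ x Dj (subst (_ ≤_) (#●-above (≰⇒> x≰r)) h)
    ... | no  x≰r̂ | yes x≤r | yes c′≤N =
      past-moved-cell m<c′ c′≤N (≰⇒> x≰r̂) x≤r Dj (subst (_ ≤_) (#●-between (≰⇒> x≰r̂) x≤r) h)
    ... | no  _   | yes _   | no c′≰N  = subst (_≤ #● U c′ x) (sym (count-none (suc j) λ y _ → empty)) z≤n
      where
      empty : ∀ {y} → column D c′ y ≡ false
      empty = column-false {D} (c′≰N ∘ lock-column≤N)

    descending′ : LabelsDescend V
    descending′ {c} {c′} c<c′ x Dj h with c ≟ m | c′ ≟ m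
    ... | yes refl | yes refl = contradiction c<c′ (<-irrefl refl)
    ... | no  c≢m  | yes refl =
      ≤-trans (descending c<c′ x Dj (subst (_ ≤_) (#●-other-column c≢m x) h)) (#●-moved-column-mono x)
    ... | no  c≢m  | no c′≢m  = subst (_ ≤_) (sym (#●-other-column c′≢m x))
      (descending c<c′ x Dj (subst (_ ≤_) (#●-other-column c≢m x) h))
    ... | yes refl | no c′≢m  = subst (_ ≤_) (sym (#●-other-column c′≢m x)) (from-moved-column c<c′ x Dj h)

  invariant-step : ∀ {U V} → Invariant U → KKStep U V → Invariant V
  invariant-step I st with kkStep⇒Move st
  ... | _ , _ , _ , mv = record
    { row₀-empty           = λ c → row₀-stays-empty (Invariant.row₀-empty I c)
    ; lowered              = lowered′
    ; bounded              = bounded′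
    ; descending           = descending′
    ; ghost-raised         = ghost-raised′
    ; ghost-row-increasing = ghost-row-increasing′
    ; ghost-row-step       = ghost-row-step′
    }
    where
    open MoveProperties mv
    open Preservation I mv

  invariant : ∀ {T} → KKD D T → Invariant T
  invariant (here T≗D)  = invariant-lock T≗D
  invariant (step R st) = invariant-step (invariant R) st

  module _ {T : Diagram} {τ : Filling} (R : KKD D T) (tab : IsLockTableau α T τ) where

    open Invariant (invariant R)
    open Tableau tab

    ghost-IsLabel : ∀ {r c} → T r c ≡ ◌ → IsLabel T r c (L T τ r c)
    ghost-IsLabel {r} {c} Tr = IsLabel-cong (#●-◌ T Tr)
      (L-IsLabel row₀-empty r c (subst (1 ≤_) (sym (#●-◌ T Tr)) (≤-trans (s≤s z≤n) (ghost-raised Tr))))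

    row≤L-ghost : ∀ r c → T r c ≡ ◌ → r ≤ L T τ r c
    row≤L-ghost r c Tr = ≤-pred (count-<⇒< {column D c}
      (<-≤-trans (ghost-raised Tr) (≤-reflexive (sym (IsLabel.rank (ghost-IsLabel Tr))))))

    L-ghost-row-increasing : ∀ r c₁ c₂ → T r c₁ ≡ ◌ → T r c₂ ≡ ◌ → c₁ < c₂ →
      L T τ r c₁ < L T τ r c₂
    L-ghost-row-increasing r c₁ c₂ T₁ T₂ c₁<c₂ =
      ghost-row-increasing T₁ T₂ c₁<c₂ (ghost-IsLabel T₁) (ghost-IsLabel T₂)

    L-ghost-row-step : ∀ r c₁ c₂ → T r c₁ ≡ ◌ → T (suc r) c₂ ≡ ◌ →
      L T τ r c₁ < L T τ (suc r) c₂ → c₁ < c₂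
    L-ghost-row-step r c₁ c₂ T₁ T₂ = ghost-row-step T₁ T₂ (ghost-IsLabel T₁) (ghost-IsLabel T₂)

    ghost-label-persists : ∀ {T̃ τ̃ r c} → KKD D T̃ → IsLockTableau α T̃ τ̃ → Reach KKStep T T̃ →
      T r c ≡ ◌ → T̃ r c ≡ ◌ × L T̃ τ̃ r c ≡ L T τ r c
    ghost-label-persists {T̃} R̃ tab̃ T→T̃ Tr with ghost-stays* T→T̃ Tr
    ... | T̃r , same = T̃r , L-determined tab̃ tab (Invariant.row₀-empty (invariant R̃)) row₀-empty
                              (trans (#●-◌ T̃ T̃r) (trans same (sym (#●-◌ T Tr))))

    ghost-move-label : ∀ {r c r̂ T̂ τ̂} → GhostMove T T̂ r c r̂ → IsLockTableau α T̂ τ̂ →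
      L T̂ τ̂ r c ≡ L T τ r c
    ghost-move-label g tab̂ =
      L-determined tab̂ tab (row₀-stays-empty ∘ row₀-empty) row₀-empty (#●-above ≤-refl)
      where open MoveProperties (ghostMove⇒Move g)

lemma3p20 : ∀ {n} (α : Vec ℕ n) (T : Diagram) (τ : Filling) →
    KKD (lockDiagram α) T → IsLockTableau α T τ →
    -- (a)
    (∀ c → (∃[ r ] lockDiagram α r c ≡ ●) →
      ∀ x → (lockDiagram α x c ≡ ●) ⇔ (∃[ r ] (T r c ≡ ● × L T τ r c ≡ x)))
    -- (b)
    × (∀ r c → T r c ≡ ● → r ≤ L T τ r c)
    -- (c)
    × (∀ r₁ r₂ c → T r₁ c ≡ ● → T r₂ c ≡ ● → r₁ < r₂ →
        L T τ r₁ c < L T τ r₂ c)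
    -- (d)
    × (∀ r₁ c₁ r₂ c₂ → T r₁ c₁ ≡ ● → T r₂ c₂ ≡ ● →
        ¬ (r₁ ≡ r₂ × c₁ ≡ c₂) → L T τ r₁ c₁ ≡ L T τ r₂ c₂ →
        c₁ ≢ c₂ × (c₁ < c₂ → r₂ ≤ r₁))
    -- (e)
    × (∀ r c → T r c ≡ ◌ → ∀ (T̃ : Diagram) (τ̃ : Filling) →
        KKD (lockDiagram α) T̃ → IsLockTableau α T̃ τ̃ → T̃ ≺ T →
        T̃ r c ≡ ◌ × L T̃ τ̃ r c ≡ L T τ r c)
    -- (f)
    × (∀ r c r̂ (T̂ : Diagram) (τ̂ : Filling) → GhostMove T T̂ r c r̂ →
        IsLockTableau α T̂ τ̂ → L T̂ τ̂ r c ≡ L T τ r c)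
    -- (g)
    × (∀ r c → T r c ≡ ◌ → r ≤ L T τ r c)
    -- (h)
    × (∀ r c₁ c₂ → T r c₁ ≡ ◌ → T r c₂ ≡ ◌ → c₁ < c₂ →
        L T τ r c₁ < L T τ r c₂)
    -- (i)
    × (∀ r c₁ c₂ → T r c₁ ≡ ◌ → T (suc r) c₂ ≡ ◌ →
        L T τ r c₁ < L T τ (suc r) c₂ → c₁ < c₂)
lemma3p20 α T τ R tab =
    (λ c _ → lock-column-labels row₀ c) -- (a) holds for empty columns as well
  , row≤L row₀
  , L-column-strict row₀
  , L-equal-labels row₀
  , (λ r c Tr T̃ τ̃ R̃ tab̃ T̃≺T → ghost-label-persists R tab R̃ tab̃ (proj₁ T̃≺T) Tr)
  , (λ r c r̂ T̂ τ̂ → ghost-move-label R tab)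
  , row≤L-ghost R tab
  , L-ghost-row-increasing R tab
  , L-ghost-row-step R tab
  where
  open Lock α {lockDiagram α} (λ _ _ → refl)
  open Reachable α {lockDiagram α} (λ _ _ → refl)
  open Tableau tab
  row₀ : ∀ c → T 0 c ≡ ∅
  row₀ = Invariant.row₀-empty (invariant R)
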